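{- Let $n \ge 1$ and let $i$ be an integer with $(3^n - 1)/2 < i < 3^n$. Then $\binom{3i}{i-1} \equiv 0 \pmod 3$. -}

module Defs where

-- Lucas' theorem mod 3, obtained from Pascal's rule applied three times
-- ((3 + n) C (3 + k) ≡ n C k + n C (3 + k) mod 3), reads binomial coefficients mod 3
-- digit by digit in base 3. If i - 1 ≢ 0 mod 3, a lower digit exceeds the upper digit 0
-- of 3i, so 3 divides the coefficient; otherwise i - 1 = 3q and the coefficient is
-- ≡ (1 + 3q) C q. Peeling off digits again, that is nonzero mod 3 only when every digit
-- of q is 1, i.e. 1 + 2q = 3^m; but then i = (3^(m+1) - 1)/2, and no power 3^n satisfies
-- i < 3^n ≤ 2i.
module Submission where

open import Defs
open import Data.Nat.Base using (ℕ; zero; suc; _+_; _*_; _∸_; _^_; _%_; _≤_; _<_; NonZero; z≤n; s≤s; z<s; s<s)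
open import Data.Nat.Properties
open import Data.Nat.Combinatorics using (_C_; nC1≡n; k>n⇒nCk≡0; nCk+nC[k+1]≡[n+1]C[k+1])
open import Data.Nat.DivMod using (%-distribˡ-+; [m+n]%n≡m%n; [m+kn]%n≡m%n)
open import Data.Nat.Divisibility using (_∣_; m%n≡0⇒n∣m; n∣m⇒m%n≡0; ∣m⇒∣m*n)
open import Data.Nat.Induction using (<-rec)
open import Data.Nat.Tactic.RingSolver using (solve-∀)
open import Data.Product using (∃-syntax; _,_)
open import Data.Sum using (_⊎_; inj₁; inj₂)
open import Data.Empty using (⊥; ⊥-elim)
open import Relation.Nullary using (yes; no; contradiction)
open import Relation.Binary.PropositionalEquality

data Mod3View : ℕ → Set where
  0+3*_ : ∀ q → Mod3View (3 * q)
  1+3*_ : ∀ q → Mod3View (1 + 3 * q)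
  2+3*_ : ∀ q → Mod3View (2 + 3 * q)

mod3View : ∀ n → Mod3View n
mod3View zero = 0+3* 0
mod3View (suc n) with mod3View n
... | 0+3* q = 1+3* q
... | 1+3* q = 2+3* q
... | 2+3* q = subst Mod3View (*-suc 3 q) (0+3* suc q)

infix 4 _≡₃_
_≡₃_ : ℕ → ℕ → Set
m ≡₃ n = m % 3 ≡ n % 3

pascal : ∀ n k → suc n C suc k ≡ n C k + n C suc k
pascal n k = sym (nCk+nC[k+1]≡[n+1]C[k+1] n k)

pascal³ : ∀ n k →
  (3 + n) C (3 + k) ≡ (n C k + n C (3 + k)) + (n C (1 + k) + n C (2 + k)) * 3
pascal³ n k = begin
  (3 + n) C (3 + k)
    ≡⟨ pascal (2 + n) (2 + k) ⟩
  (2 + n) C (2 + k) + (2 + n) C (3 + k)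
    ≡⟨ cong₂ _+_ (pascal (1 + n) (1 + k)) (pascal (1 + n) (2 + k)) ⟩
  ((1 + n) C (1 + k) + (1 + n) C (2 + k)) + ((1 + n) C (2 + k) + (1 + n) C (3 + k))
    ≡⟨ cong₂ _+_ (cong₂ _+_ (pascal n k) (pascal n (1 + k)))
                 (cong₂ _+_ (pascal n (1 + k)) (pascal n (2 + k))) ⟩
  ((n C k + n C (1 + k)) + (n C (1 + k) + n C (2 + k)))
    + ((n C (1 + k) + n C (2 + k)) + (n C (2 + k) + n C (3 + k)))
    ≡⟨ regroup (n C k) (n C (1 + k)) (n C (2 + k)) (n C (3 + k)) ⟩
  (n C k + n C (3 + k)) + (n C (1 + k) + n C (2 + k)) * 3 ∎
  where
  open ≡-Reasoning
  regroup : ∀ a b c d → ((a + b) + (b + c)) + ((b + c) + (c + d)) ≡ (a + d) + (b + c) * 3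
  regroup = solve-∀

[3+n]C[3+k]≡₃nCk+nC[3+k] : ∀ n k → (3 + n) C (3 + k) ≡₃ n C k + n C (3 + k)
[3+n]C[3+k]≡₃nCk+nC[3+k] n k =
  trans (cong (_% 3) (pascal³ n k))
        ([m+kn]%n≡m%n (n C k + n C (3 + k)) (n C (1 + k) + n C (2 + k)) 3)

[3+n]C2≡nC2+[1+n]*3 : ∀ n → (3 + n) C 2 ≡ n C 2 + (1 + n) * 3
[3+n]C2≡nC2+[1+n]*3 n = begin
  (3 + n) C 2                                     ≡⟨ pascal (2 + n) 1 ⟩
  (2 + n) C 1 + (2 + n) C 2                       ≡⟨ cong ((2 + n) C 1 +_) (pascal (1 + n) 1) ⟩
  (2 + n) C 1 + ((1 + n) C 1 + (1 + n) C 2)       ≡⟨ cong (λ x → (2 + n) C 1 + ((1 + n) C 1 + x)) (pascal n 1) ⟩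
  (2 + n) C 1 + ((1 + n) C 1 + (n C 1 + n C 2))
    ≡⟨ cong₂ _+_ (nC1≡n (2 + n)) (cong₂ _+_ (nC1≡n (1 + n)) (cong (_+ n C 2) (nC1≡n n))) ⟩
  (2 + n) + ((1 + n) + (n + n C 2))               ≡⟨ regroup n (n C 2) ⟩
  n C 2 + (1 + n) * 3                             ∎
  where
  open ≡-Reasoning
  regroup : ∀ n c → (2 + n) + ((1 + n) + (n + c)) ≡ c + (1 + n) * 3
  regroup = solve-∀

[3+n]Cd≡₃nCd : ∀ n {d} → d < 3 → (3 + n) C d ≡₃ n C d
[3+n]Cd≡₃nCd n {0} _ = refl
[3+n]Cd≡₃nCd n {1} _ = begin
  ((3 + n) C 1) % 3 ≡⟨ cong (_% 3) (trans (nC1≡n (3 + n)) (+-comm 3 n)) ⟩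
  (n + 3) % 3       ≡⟨ [m+n]%n≡m%n n 3 ⟩
  n % 3             ≡⟨ cong (_% 3) (nC1≡n n) ⟨
  (n C 1) % 3       ∎
  where open ≡-Reasoning
[3+n]Cd≡₃nCd n {2} _ =
  trans (cong (_% 3) ([3+n]C2≡nC2+[1+n]*3 n)) ([m+kn]%n≡m%n (n C 2) (1 + n) 3)
[3+n]Cd≡₃nCd n {suc (suc (suc _))} (s<s (s<s (s<s ())))

b+3[1+a]≡3+[b+3a] : ∀ b a → b + 3 * suc a ≡ 3 + (b + 3 * a)
b+3[1+a]≡3+[b+3a] = solve-∀

lucas₃ : ∀ a k {b d} → b < 3 → d < 3 → (b + 3 * a) C (d + 3 * k) ≡₃ (a C k) * (b C d)
lucas₃ zero zero {b} {d} _ _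
  rewrite +-identityʳ b | +-identityʳ d | *-identityˡ (b C d) = refl
lucas₃ zero (suc k) {b} {d} b<3 _ rewrite +-identityʳ b =
  cong (_% 3) (k>n⇒nCk≡0 (<-≤-trans b<3 (≤-trans (m≤m*n 3 (suc k)) (m≤n+m _ d))))
lucas₃ (suc a) zero {b} {d} b<3 d<3 = begin
  ((b + 3 * suc a) C (d + 0)) % 3 ≡⟨ cong₂ (λ m j → (m C j) % 3) (b+3[1+a]≡3+[b+3a] b a) (+-identityʳ d) ⟩
  ((3 + n) C d) % 3               ≡⟨ [3+n]Cd≡₃nCd n d<3 ⟩
  (n C d) % 3                     ≡⟨ cong (λ j → (n C j) % 3) (+-identityʳ d) ⟨
  (n C (d + 0)) % 3               ≡⟨ lucas₃ a zero b<3 d<3 ⟩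
  ((a C 0) * (b C d)) % 3         ∎
  where
  open ≡-Reasoning
  n = b + 3 * a
lucas₃ (suc a) (suc k) {b} {d} b<3 d<3 = begin
  ((b + 3 * suc a) C (d + 3 * suc k)) % 3
    ≡⟨ cong₂ (λ m j → (m C j) % 3) (b+3[1+a]≡3+[b+3a] b a) (b+3[1+a]≡3+[b+3a] d k) ⟩
  ((3 + n) C (3 + j)) % 3
    ≡⟨ [3+n]C[3+k]≡₃nCk+nC[3+k] n j ⟩
  (n C j + n C (3 + j)) % 3
    ≡⟨ %-distribˡ-+ (n C j) (n C (3 + j)) 3 ⟩
  ((n C j) % 3 + (n C (3 + j)) % 3) % 3
    ≡⟨ cong₂ (λ x y → (x + y) % 3) (lucas₃ a k b<3 d<3) lucas₃[a,1+k] ⟩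
  (((a C k) * c) % 3 + ((a C suc k) * c) % 3) % 3
    ≡⟨ %-distribˡ-+ ((a C k) * c) ((a C suc k) * c) 3 ⟨
  ((a C k) * c + (a C suc k) * c) % 3
    ≡⟨ cong (_% 3) (*-distribʳ-+ c (a C k) (a C suc k)) ⟨
  ((a C k + a C suc k) * c) % 3
    ≡⟨ cong (λ x → (x * c) % 3) (nCk+nC[k+1]≡[n+1]C[k+1] a k) ⟩
  ((suc a C suc k) * c) % 3 ∎
  where
  open ≡-Reasoning
  n = b + 3 * a
  j = d + 3 * k
  c = b C d
  lucas₃[a,1+k] : (n C (3 + j)) % 3 ≡ ((a C suc k) * c) % 3
  lucas₃[a,1+k] = trans (cong (λ i → (n C i) % 3) (sym (b+3[1+a]≡3+[b+3a] d k)))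
                        (lucas₃ a (suc k) b<3 d<3)

lucas₃-∣ : ∀ a k b d → b < 3 → d < 3 → 3 ∣ a C k → 3 ∣ (b + 3 * a) C (d + 3 * k)
lucas₃-∣ a k b d b<3 d<3 3∣aCk = m%n≡0⇒n∣m _ 3
  (trans (lucas₃ a k b<3 d<3) (n∣m⇒m%n≡0 _ 3 (∣m⇒∣m*n (b C d) 3∣aCk)))

lucas₃-vanish : ∀ a k b d → b < d → d < 3 → 3 ∣ (b + 3 * a) C (d + 3 * k)
lucas₃-vanish a k b d b<d d<3 = m%n≡0⇒n∣m _ 3
  (trans (lucas₃ a k (<-trans b<d d<3) d<3)
         (trans (cong (λ x → ((a C k) * x) % 3) (k>n⇒nCk≡0 b<d))
                (cong (_% 3) (*-zeroʳ (a C k)))))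

1+2[1+3q]≡3[1+2q] : ∀ q → 1 + 2 * (1 + 3 * q) ≡ 3 * (1 + 2 * q)
1+2[1+3q]≡3[1+2q] = solve-∀

3∣[3n]Cn : ∀ n → 0 < n → 3 ∣ (3 * n) C n
3∣[3n]Cn = <-rec (λ n → 0 < n → 3 ∣ (3 * n) C n) go
  where
  go : ∀ n → (∀ {m} → m < n → 0 < m → 3 ∣ (3 * m) C m) → 0 < n → 3 ∣ (3 * n) C n
  go n rec 0<n with mod3View n
  ... | 0+3* zero = ⊥-elim (<-irrefl refl 0<n)
  ... | 0+3* m@(suc _) = lucas₃-∣ (3 * m) m 0 0 z<s z<s (rec m<3m z<s)
    where
    m<3m : m < 3 * m
    m<3m = subst (m <_) (*-comm m 3) (m<m*n m 3 (s<s z<s))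
  ... | 1+3* m = lucas₃-vanish (1 + 3 * m) m 0 1 z<s (s<s z<s)
  ... | 2+3* m = lucas₃-vanish (2 + 3 * m) m 0 2 z<s (s<s (s<s z<s))

3∣[1+3n]Cn⊎1+2n≡3^m : ∀ n → 3 ∣ (1 + 3 * n) C n ⊎ ∃[ m ] 1 + 2 * n ≡ 3 ^ m
3∣[1+3n]Cn⊎1+2n≡3^m = <-rec (λ n → 3 ∣ (1 + 3 * n) C n ⊎ ∃[ m ] 1 + 2 * n ≡ 3 ^ m) go
  where
  go : ∀ n → (∀ {m} → m < n → 3 ∣ (1 + 3 * m) C m ⊎ ∃[ e ] 1 + 2 * m ≡ 3 ^ e) →
       3 ∣ (1 + 3 * n) C n ⊎ ∃[ e ] 1 + 2 * n ≡ 3 ^ e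
  go n rec with mod3View n
  ... | 0+3* zero = inj₂ (0 , refl)
  ... | 0+3* m@(suc _) = inj₁ (lucas₃-∣ (3 * m) m 1 0 (s<s z<s) z<s (3∣[3n]Cn m z<s))
  ... | 2+3* m = inj₁ (lucas₃-vanish (2 + 3 * m) m 1 2 (s<s z<s) (s<s (s<s z<s)))
  ... | 1+3* m with rec (s≤s (m≤n*m m 3))
  ...   | inj₁ 3∣[1+3m]Cm = inj₁ (lucas₃-∣ (1 + 3 * m) m 1 1 (s<s z<s) (s<s z<s) 3∣[1+3m]Cm)
  ...   | inj₂ (e , 1+2m≡3^e) = inj₂ (suc e , trans (1+2[1+3q]≡3[1+2q] m) (cong (3 *_) 1+2m≡3^e))

m∸1<n⇒m≤n : ∀ {m n} → m ∸ 1 < n → m ≤ n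
m∸1<n⇒m≤n {zero} _ = z≤n
m∸1<n⇒m≤n {suc _} m<n = m<n

b^m<b^n⇒b^[1+m]≤b^n : ∀ b .{{_ : NonZero b}} {m n} → b ^ m < b ^ n → b ^ suc m ≤ b ^ n
b^m<b^n⇒b^[1+m]≤b^n b {m} {n} b^m<b^n with n ≤? m
... | yes n≤m = contradiction (^-monoʳ-≤ b n≤m) (<⇒≱ b^m<b^n)
... | no n≰m = ^-monoʳ-≤ b (≰⇒> n≰m)

repunit-outside-window : ∀ {m n q} → 1 + 2 * q ≡ 3 ^ m →
                         3 ^ n ≤ 2 * (1 + 3 * q) → 1 + 3 * q < 3 ^ n → ⊥
repunit-outside-window {m} {n} {q} 1+2q≡3^m 3^n≤2i i<3^n = <-irrefl refl (begin-strict
  2 * i           <⟨ n<1+n (2 * i) ⟩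
  1 + 2 * i       ≡⟨ 1+2[1+3q]≡3[1+2q] q ⟩
  3 * (1 + 2 * q) ≡⟨ cong (3 *_) 1+2q≡3^m ⟩
  3 ^ suc m       ≤⟨ b^m<b^n⇒b^[1+m]≤b^n 3 {m} {n} 3^m<3^n ⟩
  3 ^ n           ≤⟨ 3^n≤2i ⟩
  2 * i           ∎)
  where
  open ≤-Reasoning
  i = 1 + 3 * q
  3^m<3^n : 3 ^ m < 3 ^ n
  3^m<3^n = begin-strict
    3 ^ m     ≡⟨ 1+2q≡3^m ⟨
    1 + 2 * q ≤⟨ +-monoʳ-≤ 1 (*-monoˡ-≤ q (n≤1+n 2)) ⟩
    i         <⟨ i<3^n ⟩
    3 ^ n     ∎

corollary1 : (n i : ℕ) → 1 ≤ n → (3 ^ n ∸ 1) < 2 * i → i < 3 ^ n → 3 ∣ (3 * i) C (i ∸ 1)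
corollary1 n zero _ () _
corollary1 n (suc j) _ lower upper with mod3View j
... | 1+3* q = lucas₃-vanish (suc (1 + 3 * q)) q 0 1 z<s (s<s z<s)
... | 2+3* q = lucas₃-vanish (suc (2 + 3 * q)) q 0 2 z<s (s<s (s<s z<s))
... | 0+3* q with 3∣[1+3n]Cn⊎1+2n≡3^m q
...   | inj₁ 3∣[1+3q]Cq = lucas₃-∣ (1 + 3 * q) q 0 0 z<s z<s 3∣[1+3q]Cq
...   | inj₂ (m , 1+2q≡3^m) =
  ⊥-elim (repunit-outside-window {m} {n} {q} 1+2q≡3^m (m∸1<n⇒m≤n lower) upper)
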